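{- For every $n\geq 0$, $|\mathcal N_n|=\sum_{k=0}^n\binom nk\mathfrak w(k)$.
   Context: A Motzkin path of length $n$ is a word $P_1\cdots P_n$ in $\{U,D,E\}$ with equally many $U$'s and $D$'s such that every prefix has at least as many $U$'s as $D$'s; $M_n$ is the set of these. $\mathcal N_n$ is the set of pairs $(X,Y)\in M_n^2$ such that for every $i\in[n]$, $(X_i,Y_i)\in\{(D,E),(D,U),(E,D),(E,E),(E,U),(U,D)\}$. $\mathfrak w(k)$ is the number of lattice walks of length $k$ in $\mathbb N^2$ with steps in $\{(-1,0),(-1,1),(0,-1),(0,1),(1,-1)\}$ starting and ending at the origin. -}

module Defs where

open import Data.Nat using (ℕ; zero; suc)
open import Data.Bool using (Bool; true; false; _∧_)
open import Data.List using (List; []; _∷_; map; concatMap; filter; length; upTo)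
open import Data.Nat.ListAction using (sum)
open import Data.Vec using (Vec; []; _∷_)
open import Data.Product using (_×_; _,_)
open import Data.Nat.Combinatorics using (_C_)
open import Relation.Binary.PropositionalEquality using (_≡_)
open import Data.Bool.Properties using (T?)
open import Relation.Nullary using (Dec)
open import Data.Bool using (T)

data Step : Set where
  U D E : Step

allSteps : List Step
allSteps = U ∷ D ∷ E ∷ []

words : {A : Set} → List A → (n : ℕ) → List (Vec A n)
words as zero    = [] ∷ []
words as (suc n) = concatMap (λ a → map (a ∷_) (words as n)) as

-- Motzkin check: starting at height h (= #U − #D of the prefix read so far),
-- every prefix keeps #U ≥ #D, and the full word ends with #U = #D.
motzkinFrom : {n : ℕ} → ℕ → Vec Step n → Bool
motzkinFrom zero    []       = true
motzkinFrom (suc h) []       = false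
motzkinFrom h       (U ∷ w)  = motzkinFrom (suc h) w
motzkinFrom zero    (D ∷ w)  = false
motzkinFrom (suc h) (D ∷ w)  = motzkinFrom h w
motzkinFrom h       (E ∷ w)  = motzkinFrom h w

isMotzkin : {n : ℕ} → Vec Step n → Bool
isMotzkin = motzkinFrom 0

M : (n : ℕ) → List (Vec Step n)
M n = filter (λ w → T? (isMotzkin w)) (words allSteps n)

allowedPair : Step → Step → Bool
allowedPair D E = true
allowedPair D U = true
allowedPair E D = true
allowedPair E E = true
allowedPair E U = true
allowedPair U D = true
allowedPair _ _ = false

allAllowed : {n : ℕ} → Vec Step n → Vec Step n → Bool
allAllowed []      []      = true
allAllowed (x ∷ X) (y ∷ Y) = allowedPair x y ∧ allAllowed X Y

𝒩 : (n : ℕ) → List (Vec Step n × Vec Step n)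
𝒩 n = filter (λ p → T? (allAllowed (Data.Product.proj₁ p) (Data.Product.proj₂ p)))
            (concatMap (λ X → map (X ,_) (M n)) (M n))

data WStep : Set where
  w₁ w₂ w₃ w₄ w₅ : WStep
-- w₁ = (-1,0), w₂ = (-1,1), w₃ = (0,-1), w₄ = (0,1), w₅ = (1,-1)

allWSteps : List WStep
allWSteps = w₁ ∷ w₂ ∷ w₃ ∷ w₄ ∷ w₅ ∷ []

walkFrom : {k : ℕ} → ℕ → ℕ → Vec WStep k → Bool
walkFrom zero    zero    []       = true
walkFrom _       _       []       = false
walkFrom zero    y       (w₁ ∷ s) = false
walkFrom (suc x) y       (w₁ ∷ s) = walkFrom x y s
walkFrom zero    y       (w₂ ∷ s) = false
walkFrom (suc x) y       (w₂ ∷ s) = walkFrom x (suc y) s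
walkFrom x       zero    (w₃ ∷ s) = false
walkFrom x       (suc y) (w₃ ∷ s) = walkFrom x y s
walkFrom x       y       (w₄ ∷ s) = walkFrom x (suc y) s
walkFrom x       zero    (w₅ ∷ s) = false
walkFrom x       (suc y) (w₅ ∷ s) = walkFrom (suc x) y s

𝔴 : ℕ → ℕ
𝔴 k = length (filter (λ s → T? (walkFrom 0 0 s)) (words allWSteps k))

sumTo : ℕ → (ℕ → ℕ) → ℕ
sumTo n f = sum (map f (upTo (suc n)))

module Submission where

open import Defs
open import Data.Nat using (ℕ; _*_)
open import Data.Nat.Combinatorics using (_C_)
open import Data.List using (length)
open import Relation.Binary.PropositionalEquality using (_≡_)

open import Data.Nat using (zero; suc; _+_)
open import Data.Nat.Properties
  using (n<1+n; +-assoc; +-commutativeSemigroup; +-identityʳ; *-identityˡ; *-zeroʳ; *-distribˡ-+; *-distribʳ-+)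
open import Data.Nat.Combinatorics using (nCk+nC[k+1]≡[n+1]C[k+1])
open import Data.Nat.Combinatorics.Specification using (k>n⇒nCk≡0)
open import Data.Nat.Tactic.RingSolver using (solve-∀)
open import Algebra.Properties.CommutativeSemigroup +-commutativeSemigroup
  using () renaming (interchange to +-interchange)
open import Data.Bool using (Bool; true; false; _∧_; if_then_else_)
open import Data.Bool.Properties using (T?; ∧-zeroʳ)
open import Data.List using (List; []; _∷_; _++_; map; concatMap; filter; applyUpTo)
open import Data.Nat.ListAction using (sum)
open import Data.Vec using (Vec; _∷_; unzip)
open import Data.Product using (_×_; _,_; proj₁; proj₂)
open import Data.Maybe using (Maybe; just; nothing; maybe′; zip)
open import Function using (_∘_)
open import Relation.Binary.PropositionalEquality using (refl; sym; trans; cong; cong₂; module ≡-Reasoning)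

-- Read a pair (X , Y) ∈ 𝒩_n letter by letter and record the pair of
-- heights (#U − #D of the prefixes of X and of Y).  The letter pair (E , E) leaves
-- the heights unchanged, and the five other allowed letter pairs move them by exactly
-- the five walk steps (-1,0),(-1,1),(0,-1),(0,1),(1,-1).  So 𝒩_n counts "lazy" walks
-- of length n in ℕ² (walks that may also pause), and choosing the k moving positions
-- gives  |𝒩_n| = Σ_k (n choose k) 𝔴(k).

sumOver : {A : Set} → List A → (A → ℕ) → ℕ
sumOver []       f = 0
sumOver (x ∷ xs) f = f x + sumOver xs f

sumOver-cong : {A : Set} (xs : List A) {f g : A → ℕ} →
               (∀ x → f x ≡ g x) → sumOver xs f ≡ sumOver xs g
sumOver-cong []       e = refl
sumOver-cong (x ∷ xs) e = cong₂ _+_ (e x) (sumOver-cong xs e)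

sumOver-zero : {A : Set} (xs : List A) → sumOver xs (λ _ → 0) ≡ 0
sumOver-zero []       = refl
sumOver-zero (x ∷ xs) = sumOver-zero xs

sumOver-+ : {A : Set} (xs : List A) (f g : A → ℕ) →
            sumOver xs (λ x → f x + g x) ≡ sumOver xs f + sumOver xs g
sumOver-+ []       f g = refl
sumOver-+ (x ∷ xs) f g rewrite sumOver-+ xs f g =
  +-interchange (f x) (g x) (sumOver xs f) (sumOver xs g)

sumOver-swap : {A B : Set} (xs : List A) (ys : List B) (f : A → B → ℕ) →
  sumOver xs (λ x → sumOver ys (f x)) ≡ sumOver ys (λ y → sumOver xs (λ x → f x y))
sumOver-swap []       ys f = sym (sumOver-zero ys)
sumOver-swap (x ∷ xs) ys f = begin
    sumOver ys (f x) + sumOver xs (λ x′ → sumOver ys (f x′))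
  ≡⟨ cong (sumOver ys (f x) +_) (sumOver-swap xs ys f) ⟩
    sumOver ys (f x) + sumOver ys (λ y → sumOver xs (λ x′ → f x′ y))
  ≡⟨ sym (sumOver-+ ys (f x) _) ⟩
    sumOver ys (λ y → f x y + sumOver xs (λ x′ → f x′ y)) ∎
  where open ≡-Reasoning

sumOver-++ : {A : Set} (xs ys : List A) (f : A → ℕ) →
             sumOver (xs ++ ys) f ≡ sumOver xs f + sumOver ys f
sumOver-++ []       ys f = refl
sumOver-++ (x ∷ xs) ys f = trans (cong (f x +_) (sumOver-++ xs ys f)) (sym (+-assoc (f x) _ _))

sumOver-map : {A B : Set} (g : A → B) (xs : List A) (f : B → ℕ) →
              sumOver (map g xs) f ≡ sumOver xs (f ∘ g)
sumOver-map g []       f = refl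
sumOver-map g (x ∷ xs) f = cong (f (g x) +_) (sumOver-map g xs f)

sumOver-concatMap : {A B : Set} (g : A → List B) (xs : List A) (f : B → ℕ) →
  sumOver (concatMap g xs) f ≡ sumOver xs (λ x → sumOver (g x) f)
sumOver-concatMap g []       f = refl
sumOver-concatMap g (x ∷ xs) f =
  trans (sumOver-++ (g x) (concatMap g xs) f) (cong (sumOver (g x) f +_) (sumOver-concatMap g xs f))

sumOver-filter : {A : Set} (p : A → Bool) (xs : List A) (f : A → ℕ) →
  sumOver (filter (λ x → T? (p x)) xs) f ≡ sumOver xs (λ x → if p x then f x else 0)
sumOver-filter p []       f = refl
sumOver-filter p (x ∷ xs) f with p x
... | true  = cong (f x +_) (sumOver-filter p xs f)
... | false = sumOver-filter p xs f

-- The list of all pairs, in the order used by the definition of 𝒩.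
_⊗_ : {A B : Set} → List A → List B → List (A × B)
xs ⊗ ys = concatMap (λ x → map (x ,_) ys) xs

sumOver-⊗ : {A B : Set} (xs : List A) (ys : List B) (f : A × B → ℕ) →
  sumOver (xs ⊗ ys) f ≡ sumOver xs (λ x → sumOver ys (λ y → f (x , y)))
sumOver-⊗ xs ys f = trans (sumOver-concatMap (λ x → map (x ,_) ys) xs f)
                          (sumOver-cong xs (λ x → sumOver-map (x ,_) ys f))

sumOver-words : {A : Set} (as : List A) (n : ℕ) (f : Vec A (suc n) → ℕ) →
  sumOver (words as (suc n)) f ≡ sumOver as (λ a → sumOver (words as n) (f ∘ (a ∷_)))
sumOver-words as n f = trans (sumOver-concatMap (λ a → map (a ∷_) (words as n)) as f)
                             (sumOver-cong as (λ a → sumOver-map (a ∷_) (words as n) f))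

-- Summing over pairs of words of length n is summing over words of letter pairs,
-- read back through unzip.  This lets a pair of words be processed as a single word.
sumOver-wordPairs : {A B : Set} (as : List A) (bs : List B) (n : ℕ) (f : Vec A n × Vec B n → ℕ) →
  sumOver (words as n ⊗ words bs n) f ≡ sumOver (words (as ⊗ bs) n) (f ∘ unzip)
sumOver-wordPairs as bs zero    f = refl
sumOver-wordPairs {A} {B} as bs (suc n) f = begin
    sumOver (words as (suc n) ⊗ words bs (suc n)) f
  ≡⟨ sumOver-⊗ (words as (suc n)) (words bs (suc n)) f ⟩
    sumOver (words as (suc n)) (λ X → sumOver (words bs (suc n)) (λ Y → f (X , Y)))
  ≡⟨ sumOver-words as n _ ⟩
    sumOver as (λ a → sumOver Wa (λ X → sumOver (words bs (suc n)) (λ Y → f (a ∷ X , Y))))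
  ≡⟨ sumOver-cong as (λ a → sumOver-cong Wa (λ X → sumOver-words bs n _)) ⟩
    sumOver as (λ a → sumOver Wa (λ X → sumOver bs (λ b → sumOver Wb (λ Y → f (a ∷ X , b ∷ Y)))))
  ≡⟨ sumOver-cong as (λ a → sumOver-swap Wa bs _) ⟩
    sumOver as (λ a → sumOver bs (λ b → sumOver Wa (λ X → sumOver Wb (λ Y → f (a ∷ X , b ∷ Y)))))
  ≡⟨ sumOver-cong as (λ a → sumOver-cong bs (λ b →
       trans (sym (sumOver-⊗ Wa Wb _)) (sumOver-wordPairs as bs n _))) ⟩
    sumOver as (λ a → sumOver bs (λ b → sumOver (words (as ⊗ bs) n) (f ∘ unzip ∘ ((a , b) ∷_))))
  ≡⟨ sym (sumOver-⊗ as bs _) ⟩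
    sumOver (as ⊗ bs) (λ ab → sumOver (words (as ⊗ bs) n) (f ∘ unzip ∘ (ab ∷_)))
  ≡⟨ sym (sumOver-words (as ⊗ bs) n _) ⟩
    sumOver (words (as ⊗ bs) (suc n)) (f ∘ unzip) ∎
  where
  open ≡-Reasoning
  Wa : List (Vec A n)
  Wa = words as n
  Wb : List (Vec B n)
  Wb = words bs n

count : {A : Set} → (A → Bool) → List A → ℕ
count p xs = sumOver xs (λ x → if p x then 1 else 0)

length-filter : {A : Set} (p : A → Bool) (xs : List A) →
                length (filter (λ x → T? (p x)) xs) ≡ count p xs
length-filter p []       = refl
length-filter p (x ∷ xs) with p x
... | true  = cong suc (length-filter p xs)
... | false = length-filter p xs

transfer : {S Q : Set} → List S → (S → Q → Maybe Q) → (Q → ℕ) → Q → ℕ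
transfer steps move f q = sumOver steps (λ s → maybe′ f 0 (move s q))

transfer-cong : {S Q : Set} (steps : List S) (move : S → Q → Maybe Q) {f g : Q → ℕ} →
                (∀ q → f q ≡ g q) → ∀ q → transfer steps move f q ≡ transfer steps move g q
transfer-cong steps move {f} {g} e q = sumOver-cong steps (λ s → maybe-cong (move s q))
  where
  maybe-cong : ∀ m → maybe′ f 0 m ≡ maybe′ g 0 m
  maybe-cong nothing  = refl
  maybe-cong (just q′) = e q′

accepted-suc : {A Q : Set} (alphabet : List A) (δ : A → Q → Maybe Q)
  (accepts : ∀ {n} → Q → Vec A n → Bool) →
  (∀ {n} a q (w : Vec A n) → accepts q (a ∷ w) ≡ maybe′ (λ q′ → accepts q′ w) false (δ a q)) →
  ∀ n q → count (accepts q) (words alphabet (suc n))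
          ≡ transfer alphabet δ (λ q′ → count (accepts q′) (words alphabet n)) q
accepted-suc {A} alphabet δ accepts accepts-∷ n q =
  trans (sumOver-words alphabet n _)
        (sumOver-cong alphabet (λ a →
           trans (sumOver-cong W (λ w → cong (λ b → if b then 1 else 0) (accepts-∷ a q w)))
                 (after (δ a q))))
  where
  W : List (Vec A n)
  W = words alphabet n
  after : ∀ m → sumOver W (λ w → if maybe′ (λ q′ → accepts q′ w) false m then 1 else 0)
                ≡ maybe′ (λ q′ → count (accepts q′) W) 0 m
  after nothing   = sumOver-zero W
  after (just q′) = refl

rangeSum : ℕ → (ℕ → ℕ) → ℕ
rangeSum zero    g = 0
rangeSum (suc m) g = g 0 + rangeSum m (g ∘ suc)

rangeSum-cong : ∀ m {g h : ℕ → ℕ} → (∀ k → g k ≡ h k) → rangeSum m g ≡ rangeSum m h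
rangeSum-cong zero    e = refl
rangeSum-cong (suc m) e = cong₂ _+_ (e 0) (rangeSum-cong m (e ∘ suc))

rangeSum-+ : ∀ m (g h : ℕ → ℕ) → rangeSum m (λ k → g k + h k) ≡ rangeSum m g + rangeSum m h
rangeSum-+ zero    g h = refl
rangeSum-+ (suc m) g h rewrite rangeSum-+ m (g ∘ suc) (h ∘ suc) =
  +-interchange (g 0) (h 0) (rangeSum m (g ∘ suc)) (rangeSum m (h ∘ suc))

rangeSum-zero : ∀ m (g : ℕ → ℕ) → (∀ k → g k ≡ 0) → rangeSum m g ≡ 0
rangeSum-zero zero    g e = refl
rangeSum-zero (suc m) g e rewrite e 0 = rangeSum-zero m (g ∘ suc) (e ∘ suc)

rangeSum-last : ∀ m (g : ℕ → ℕ) → rangeSum (suc m) g ≡ rangeSum m g + g m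
rangeSum-last zero    g = +-identityʳ (g 0)
rangeSum-last (suc m) g rewrite rangeSum-last m (g ∘ suc) = sym (+-assoc (g 0) _ _)

sum-applyUpTo : ∀ m (i g : ℕ → ℕ) → sum (map g (applyUpTo i m)) ≡ rangeSum m (g ∘ i)
sum-applyUpTo zero    i g = refl
sum-applyUpTo (suc m) i g = cong (g (i 0) +_) (sum-applyUpTo m (i ∘ suc) g)

sumTo-rangeSum : ∀ n (g : ℕ → ℕ) → sumTo n g ≡ rangeSum (suc n) g
sumTo-rangeSum n g = sum-applyUpTo (suc n) (λ k → k) g

binomial : ℕ → (ℕ → ℕ) → ℕ
binomial n f = rangeSum (suc n) (λ k → (n C k) * f k)

binomial-cong : ∀ n {f g : ℕ → ℕ} → (∀ k → f k ≡ g k) → binomial n f ≡ binomial n g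
binomial-cong n e = rangeSum-cong (suc n) (λ k → cong ((n C k) *_) (e k))

binomial-+ : ∀ n (f g : ℕ → ℕ) → binomial n (λ k → f k + g k) ≡ binomial n f + binomial n g
binomial-+ n f g = trans (rangeSum-cong (suc n) (λ k → *-distribˡ-+ (n C k) (f k) (g k)))
                         (rangeSum-+ (suc n) (λ k → (n C k) * f k) (λ k → (n C k) * g k))

binomial-zero : ∀ n → binomial n (λ _ → 0) ≡ 0
binomial-zero n = rangeSum-zero (suc n) _ (λ k → *-zeroʳ (n C k))

binomial-at-0 : (f : ℕ → ℕ) → binomial 0 f ≡ f 0
binomial-at-0 f = trans (+-identityʳ (1 * f 0)) (*-identityˡ (f 0))

binomial-suc : ∀ n (f : ℕ → ℕ) → binomial (suc n) f ≡ binomial n f + binomial n (f ∘ suc)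
binomial-suc n f = begin
    1 * f 0 + rangeSum (suc n) (λ k → (suc n C suc k) * f (suc k))
  ≡⟨ cong₂ _+_ (*-identityˡ (f 0)) (rangeSum-cong (suc n) pascal) ⟩
    f 0 + rangeSum (suc n) (λ k → (n C k) * f (suc k) + h k)
  ≡⟨ cong (f 0 +_) (rangeSum-+ (suc n) (λ k → (n C k) * f (suc k)) h) ⟩
    f 0 + (shifted + rangeSum (suc n) h)
  ≡⟨ cong (λ t → f 0 + (shifted + t)) (rangeSum-last n h) ⟩
    f 0 + (shifted + (rangeSum n h + (n C suc n) * f (suc n)))
  ≡⟨ cong (λ t → f 0 + (shifted + (rangeSum n h + t * f (suc n)))) (k>n⇒nCk≡0 (n<1+n n)) ⟩
    f 0 + (shifted + (rangeSum n h + 0))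
  ≡⟨ regroup (f 0) shifted (rangeSum n h) ⟩
    (f 0 + rangeSum n h) + shifted
  ≡⟨ cong (λ t → t + rangeSum n h + shifted) (sym (*-identityˡ (f 0))) ⟩
    binomial n f + binomial n (f ∘ suc) ∎
  where
  open ≡-Reasoning
  shifted : ℕ
  shifted = binomial n (f ∘ suc)
  h : ℕ → ℕ
  h k = (n C suc k) * f (suc k)
  pascal : ∀ k → (suc n C suc k) * f (suc k) ≡ (n C k) * f (suc k) + h k
  pascal k = trans (cong (_* f (suc k)) (sym (nCk+nC[k+1]≡[n+1]C[k+1] n k)))
                   (*-distribʳ-+ (f (suc k)) (n C k) (n C suc k))
  regroup : ∀ a x s → a + (x + (s + 0)) ≡ (a + s) + x
  regroup = solve-∀

-- The binomial transform is linear, so it commutes with transfer operators.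
binomial-transfer : ∀ n {S Q : Set} (steps : List S) (move : S → Q → Maybe Q)
  (g : ℕ → Q → ℕ) (q : Q) →
  binomial n (λ k → transfer steps move (g k) q)
    ≡ transfer steps move (λ q′ → binomial n (λ k → g k q′)) q
binomial-transfer n {S} steps move g q = binomial-sumOver steps
  where
  binomial-maybe : ∀ m → binomial n (λ k → maybe′ (g k) 0 m)
                         ≡ maybe′ (λ q′ → binomial n (λ k → g k q′)) 0 m
  binomial-maybe nothing   = binomial-zero n
  binomial-maybe (just q′) = refl
  binomial-sumOver : (ss : List S) → binomial n (λ k → transfer ss move (g k) q)
                                     ≡ transfer ss move (λ q′ → binomial n (λ k → g k q′)) q
  binomial-sumOver []       = binomial-zero n
  binomial-sumOver (s ∷ ss) =
    trans (binomial-+ n (λ k → maybe′ (g k) 0 (move s q)) (λ k → transfer ss move (g k) q))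
          (cong₂ _+_ (binomial-maybe (move s q)) (binomial-sumOver ss))

-- If f n q counts length-n paths from q that at each step either pause or
-- make a step of the dynamics, and g k q counts length-k paths that never pause (both
-- with the same final condition, so f 0 = g 0), then choosing the k non-pausing
-- positions gives  f n q = Σ_k (n choose k) g k q.
lazy-binomial : {S Q : Set} (steps : List S) (move : S → Q → Maybe Q) (f g : ℕ → Q → ℕ) →
  (∀ q → f 0 q ≡ g 0 q) →
  (∀ n q → f (suc n) q ≡ f n q + transfer steps move (f n) q) →
  (∀ k q → g (suc k) q ≡ transfer steps move (g k) q) →
  ∀ n q → f n q ≡ binomial n (λ k → g k q)
lazy-binomial steps move f g f0≡g0 f-suc g-suc zero q = trans (f0≡g0 q) (sym (binomial-at-0 (λ k → g k q)))
lazy-binomial steps move f g f0≡g0 f-suc g-suc (suc n) q = begin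
    f (suc n) q
  ≡⟨ f-suc n q ⟩
    f n q + transfer steps move (f n) q
  ≡⟨ cong₂ _+_ (induction q) (transfer-cong steps move induction q) ⟩
    binomial n (λ k → g k q) + transfer steps move (λ q′ → binomial n (λ k → g k q′)) q
  ≡⟨ cong (binomial n (λ k → g k q) +_) (sym (binomial-transfer n steps move g q)) ⟩
    binomial n (λ k → g k q) + binomial n (λ k → transfer steps move (g k) q)
  ≡⟨ cong (binomial n (λ k → g k q) +_) (binomial-cong n (λ k → sym (g-suc k q))) ⟩
    binomial n (λ k → g k q) + binomial n (λ k → g (suc k) q)
  ≡⟨ sym (binomial-suc n (λ k → g k q)) ⟩
    binomial (suc n) (λ k → g k q) ∎
  where
  open ≡-Reasoning
  induction : ∀ q → f n q ≡ binomial n (λ k → g k q)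
  induction = lazy-binomial steps move f g f0≡g0 f-suc g-suc n

walkMove : WStep → ℕ × ℕ → Maybe (ℕ × ℕ)
walkMove w₁ (suc x , y) = just (x , y)
walkMove w₂ (suc x , y) = just (x , suc y)
walkMove w₃ (x , suc y) = just (x , y)
walkMove w₄ (x , y)     = just (x , suc y)
walkMove w₅ (x , suc y) = just (suc x , y)
walkMove _  _           = nothing

walkAccepts : {k : ℕ} → ℕ × ℕ → Vec WStep k → Bool
walkAccepts (x , y) = walkFrom x y

walkAccepts-∷ : ∀ {k} s q (S : Vec WStep k) →
  walkAccepts q (s ∷ S) ≡ maybe′ (λ q′ → walkAccepts q′ S) false (walkMove s q)
walkAccepts-∷ w₁ (zero  , zero)  S = refl
walkAccepts-∷ w₁ (zero  , suc y) S = refl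
walkAccepts-∷ w₁ (suc x , zero)  S = refl
walkAccepts-∷ w₁ (suc x , suc y) S = refl
walkAccepts-∷ w₂ (zero  , zero)  S = refl
walkAccepts-∷ w₂ (zero  , suc y) S = refl
walkAccepts-∷ w₂ (suc x , zero)  S = refl
walkAccepts-∷ w₂ (suc x , suc y) S = refl
walkAccepts-∷ w₃ (zero  , zero)  S = refl
walkAccepts-∷ w₃ (zero  , suc y) S = refl
walkAccepts-∷ w₃ (suc x , zero)  S = refl
walkAccepts-∷ w₃ (suc x , suc y) S = refl
walkAccepts-∷ w₄ (zero  , zero)  S = refl
walkAccepts-∷ w₄ (zero  , suc y) S = refl
walkAccepts-∷ w₄ (suc x , zero)  S = refl
walkAccepts-∷ w₄ (suc x , suc y) S = refl
walkAccepts-∷ w₅ (zero  , zero)  S = refl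
walkAccepts-∷ w₅ (zero  , suc y) S = refl
walkAccepts-∷ w₅ (suc x , zero)  S = refl
walkAccepts-∷ w₅ (suc x , suc y) S = refl

walks : ℕ → ℕ × ℕ → ℕ
walks k q = count (walkAccepts q) (words allWSteps k)

walks-suc : ∀ k q → walks (suc k) q ≡ transfer allWSteps walkMove (walks k) q
walks-suc = accepted-suc allWSteps walkMove walkAccepts walkAccepts-∷

𝔴-walks : ∀ k → 𝔴 k ≡ walks k (0 , 0)
𝔴-walks k = length-filter (walkFrom 0 0) (words allWSteps k)

heightMove : Step → ℕ → Maybe ℕ
heightMove U h       = just (suc h)
heightMove D zero    = nothing
heightMove D (suc h) = just h
heightMove E h       = just h

motzkinFrom-∷ : ∀ {n} x h (w : Vec Step n) →
  motzkinFrom h (x ∷ w) ≡ maybe′ (λ h′ → motzkinFrom h′ w) false (heightMove x h)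
motzkinFrom-∷ U zero    w = refl
motzkinFrom-∷ U (suc h) w = refl
motzkinFrom-∷ D zero    w = refl
motzkinFrom-∷ D (suc h) w = refl
motzkinFrom-∷ E zero    w = refl
motzkinFrom-∷ E (suc h) w = refl

-- Pairs of words are read as words of letter pairs; the state is the pair of heights.
-- A letter pair moves both heights, provided it is an allowed pair.
allPairs : List (Step × Step)
allPairs = allSteps ⊗ allSteps

pairMove : Step × Step → ℕ × ℕ → Maybe (ℕ × ℕ)
pairMove (x , y) (a , b) = if allowedPair x y then zip (heightMove x a) (heightMove y b) else nothing

pairAccepts : {n : ℕ} → ℕ × ℕ → Vec Step n × Vec Step n → Bool
pairAccepts (a , b) (X , Y) = motzkinFrom a X ∧ (motzkinFrom b Y ∧ allAllowed X Y)

pairAccepts-∷ : ∀ {n} xy q (w : Vec (Step × Step) n) →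
  pairAccepts q (unzip (xy ∷ w)) ≡ maybe′ (λ q′ → pairAccepts q′ (unzip w)) false (pairMove xy q)
pairAccepts-∷ (x , y) (a , b) w
  rewrite motzkinFrom-∷ x a (proj₁ (unzip w)) | motzkinFrom-∷ y b (proj₂ (unzip w))
  with allowedPair x y | heightMove x a | heightMove y b
... | false | hx       | hy       =
  trans (cong (maybe′ _ false hx ∧_) (∧-zeroʳ (maybe′ _ false hy))) (∧-zeroʳ (maybe′ _ false hx))
... | true  | nothing  | hy       = refl
... | true  | just a′  | nothing  = ∧-zeroʳ (motzkinFrom a′ (proj₁ (unzip w)))
... | true  | just a′  | just b′  = refl

pairs : ℕ → ℕ × ℕ → ℕ
pairs n q = count (pairAccepts q ∘ unzip) (words allPairs n)

pairs-transfer : ∀ n q → pairs (suc n) q ≡ transfer allPairs pairMove (pairs n) q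
pairs-transfer = accepted-suc allPairs pairMove (λ q → pairAccepts q ∘ unzip) pairAccepts-∷

-- The key observation: an allowed letter pair either pauses (E , E) or changes the
-- heights by one of the five walk steps; forbidden pairs are blocked.
data PairKind : Set where
  pause   : PairKind
  step    : WStep → PairKind
  blocked : PairKind

kind : Step × Step → PairKind
kind (D , E) = step w₁
kind (D , U) = step w₂
kind (E , D) = step w₃
kind (E , U) = step w₄
kind (U , D) = step w₅
kind (E , E) = pause
kind _       = blocked

effect : PairKind → ℕ × ℕ → Maybe (ℕ × ℕ)
effect pause    q = just q
effect (step s) q = walkMove s q
effect blocked  q = nothing

pairMove-kind : ∀ xy q → pairMove xy q ≡ effect (kind xy) q
pairMove-kind (U , U) q           = refl
pairMove-kind (U , D) (a , zero)  = refl
pairMove-kind (U , D) (a , suc b) = refl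
pairMove-kind (U , E) q           = refl
pairMove-kind (D , U) (zero  , b) = refl
pairMove-kind (D , U) (suc a , b) = refl
pairMove-kind (D , D) q           = refl
pairMove-kind (D , E) (zero  , b) = refl
pairMove-kind (D , E) (suc a , b) = refl
pairMove-kind (E , U) q           = refl
pairMove-kind (E , D) (a , zero)  = refl
pairMove-kind (E , D) (a , suc b) = refl
pairMove-kind (E , E) q           = refl

pairs-transfer-walk : (h : ℕ × ℕ → ℕ) (q : ℕ × ℕ) →
  transfer allPairs pairMove h q ≡ h q + transfer allWSteps walkMove h q
pairs-transfer-walk h q =
  trans (sumOver-cong allPairs (λ xy → cong (maybe′ h 0) (pairMove-kind xy q)))
        (regroup (t w₁) (t w₂) (t w₃) (t w₄) (t w₅) (h q))
  where
  t : WStep → ℕ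
  t s = maybe′ h 0 (walkMove s q)
  -- the pairs UU UD UE DU DD DE EU ED EE contribute 0 t₅ 0 t₂ 0 t₁ t₄ t₃ e
  regroup : ∀ t₁ t₂ t₃ t₄ t₅ e →
    0 + (t₅ + (0 + (t₂ + (0 + (t₁ + (t₄ + (t₃ + (e + 0))))))))
      ≡ e + (t₁ + (t₂ + (t₃ + (t₄ + (t₅ + 0)))))
  regroup = solve-∀

pairs-suc : ∀ n q → pairs (suc n) q ≡ pairs n q + transfer allWSteps walkMove (pairs n) q
pairs-suc n q = trans (pairs-transfer n q) (pairs-transfer-walk (pairs n) q)

pairs-0 : ∀ q → pairs 0 q ≡ walks 0 q
pairs-0 (zero  , zero)  = refl
pairs-0 (zero  , suc b) = refl
pairs-0 (suc a , zero)  = refl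
pairs-0 (suc a , suc b) = refl

-- 𝒩_n is counted by the pair automaton from heights (0 , 0): filtering by the Motzkin
-- condition on each coordinate and by allowedness is one conjunctive test.
𝒩-pairs : ∀ n → length (𝒩 n) ≡ pairs n (0 , 0)
𝒩-pairs n = begin
    length (𝒩 n)
  ≡⟨ length-filter (λ XY → allAllowed (proj₁ XY) (proj₂ XY)) (M n ⊗ M n) ⟩
    sumOver (M n ⊗ M n) (λ XY → 𝟙 (allAllowed (proj₁ XY) (proj₂ XY)))
  ≡⟨ sumOver-⊗ (M n) (M n) _ ⟩
    sumOver (M n) (λ X → sumOver (M n) (λ Y → 𝟙 (allAllowed X Y)))
  ≡⟨ sumOver-filter isMotzkin W _ ⟩
    sumOver W (λ X → if isMotzkin X then sumOver (M n) (λ Y → 𝟙 (allAllowed X Y)) else 0)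
  ≡⟨ sumOver-cong W (λ X → cong (λ s → if isMotzkin X then s else 0)
       (trans (sumOver-filter isMotzkin W _) (sumOver-cong W (λ Y → if-𝟙 (isMotzkin Y) _)))) ⟩
    sumOver W (λ X → if isMotzkin X then sumOver W (λ Y → 𝟙 (isMotzkin Y ∧ allAllowed X Y)) else 0)
  ≡⟨ sumOver-cong W (λ X → if-sumOver (isMotzkin X) _) ⟩
    sumOver W (λ X → sumOver W (λ Y → 𝟙 (pairAccepts (0 , 0) (X , Y))))
  ≡⟨ sym (sumOver-⊗ W W _) ⟩
    sumOver (W ⊗ W) (𝟙 ∘ pairAccepts (0 , 0))
  ≡⟨ sumOver-wordPairs allSteps allSteps n _ ⟩
    pairs n (0 , 0) ∎
  where
  open ≡-Reasoning
  W : List (Vec Step n)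
  W = words allSteps n
  𝟙 : Bool → ℕ
  𝟙 b = if b then 1 else 0
  if-𝟙 : ∀ b c → (if b then 𝟙 c else 0) ≡ 𝟙 (b ∧ c)
  if-𝟙 true  c = refl
  if-𝟙 false c = refl
  if-sumOver : ∀ b (g : Vec Step n → Bool) →
    (if b then sumOver W (𝟙 ∘ g) else 0) ≡ sumOver W (λ Y → 𝟙 (b ∧ g Y))
  if-sumOver true  g = refl
  if-sumOver false g = sym (sumOver-zero W)

proposition4p3 : (n : ℕ) → length (𝒩 n) ≡ sumTo n (λ k → (n C k) * 𝔴 k)
proposition4p3 n = begin
    length (𝒩 n)
  ≡⟨ 𝒩-pairs n ⟩
    pairs n (0 , 0)
  ≡⟨ lazy-binomial allWSteps walkMove pairs walks pairs-0 pairs-suc walks-suc n (0 , 0) ⟩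
    binomial n (λ k → walks k (0 , 0))
  ≡⟨ binomial-cong n (λ k → sym (𝔴-walks k)) ⟩
    binomial n 𝔴
  ≡⟨ sym (sumTo-rangeSum n (λ k → (n C k) * 𝔴 k)) ⟩
    sumTo n (λ k → (n C k) * 𝔴 k) ∎
  where open ≡-Reasoning
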